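{- Let $P$ be a $k\times\ell$ pipe dream and $\alpha\ge0$, and let $\alpha|P$ be the $k\times(\ell+\alpha)$ pipe dream obtained by adding $\alpha$ columns consisting entirely of crosses to the left side of $P$. Then $P$ simplifies to $D$ if and only if $\alpha|P$ simplifies to $\alpha|D$.
   Context: A pipe dream is a finite set of boxes (crosses) in a grid. Its word lists $s_{i+j-1}$ for each cross in row $i$, column $j$, reading each row right to left, rows top to bottom; subsets of $P$ correspond to subwords. The Demazure product $\delta(P)\in S_\infty$ is the product of the word computed using $s_i^2=s_i$ and the braid relations. Writing $P_{\le i}$ for the initial string of the first $i$ reflections of the word of $P$, $P$ simplifies to $D\subseteq P$ if $D$ is the lexicographically first subword of $P$ with Demazure product $\delta(P)$; equivalently $D$ is obtained from $P$ by omitting the $i$-th reflection for every $i$ with $\delta(P_{\le i-1})=\delta(P_{\le i})$. -}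

module Defs where

open import Data.Nat using (ℕ; zero; suc; _+_; _≡ᵇ_; _<ᵇ_)
open import Data.Bool using (Bool; true; false; if_then_else_)
open import Data.Fin using (Fin; toℕ; splitAt)
open import Data.List using (List; []; _∷_; [_]; _++_; concatMap; reverse; map; foldl; take; length; lookup)
open import Data.Sum using (inj₁; inj₂)
open import Data.Product using (Σ; _×_; _,_)
open import Relation.Binary.PropositionalEquality using (_≡_)
open import Relation.Nullary using (¬_)
open import Function.Bundles using (_⇔_)

finList : (n : ℕ) → List (Fin n)
finList zero = []
finList (suc n) = Fin.zero ∷ map Fin.suc (finList n)

-- A k × ℓ pipe dream: the cell (r , c) (0-indexed) is a cross iff P r c ≡ true.
PipeDream : ℕ → ℕ → Set
PipeDream k ℓ = Fin k → Fin ℓ → Bool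

-- Elements of S_∞ in one-line notation, as maps ℕ → ℕ (0-indexed positions),
-- and equality of permutations (pointwise).
Perm : Set
Perm = ℕ → ℕ

idPerm : Perm
idPerm n = n

_≈ₚ_ : Perm → Perm → Set
w ≈ₚ v = ∀ n → w n ≡ v n

-- w · s_a : swap the values at positions a and a+1 (0-indexed letter a
-- corresponds to the simple transposition s_{a+1} of the paper).
swapRight : Perm → ℕ → Perm
swapRight w a n = if n ≡ᵇ a then w (suc a)
                  else if n ≡ᵇ suc a then w a
                  else w n

-- Demazure (0-Hecke) product with a simple reflection on the right:
-- w ⋆ s_a = w s_a if ℓ(w s_a) > ℓ(w) (i.e. w(a) < w(a+1)), and w otherwise.
demStep : Perm → ℕ → Perm
demStep w a = if w a <ᵇ w (suc a) then swapRight w a else w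

δ : List ℕ → Perm
δ = foldl demStep idPerm

crosses : {k ℓ : ℕ} → PipeDream k ℓ → List (Fin k × Fin ℓ)
crosses {k} {ℓ} P =
  concatMap (λ r → concatMap (λ c → if P r c then [ (r , c) ] else [])
                             (reverse (finList ℓ)))
            (finList k)

-- The letter of the cross in row i, column j (1-indexed) is s_{i+j-1};
-- with 0-indexed rows/columns and 0-indexed letters this is r + c.
letter : {k ℓ : ℕ} → Fin k × Fin ℓ → ℕ
letter (r , c) = toℕ r + toℕ c

word : {k ℓ : ℕ} → PipeDream k ℓ → List ℕ
word P = map letter (crosses P)

-- P simplifies to D: D consists exactly of the crosses of P at those
-- positions t (0-indexed; the (t+1)-st reflection) of the word with
-- δ(P_{≤ t}) ≠ δ(P_{≤ t+1}); i.e. D is P with every reflection i with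
-- δ(P_{≤ i-1}) = δ(P_{≤ i}) omitted.
Simplifies : {k ℓ : ℕ} → PipeDream k ℓ → PipeDream k ℓ → Set
Simplifies P D =
  ∀ r c → D r c ≡ true ⇔
    Σ (Fin (length (crosses P))) λ t →
      (lookup (crosses P) t ≡ (r , c)) ×
      ¬ (δ (take (toℕ t) (word P)) ≈ₚ δ (take (suc (toℕ t)) (word P)))

addCols : {k ℓ : ℕ} (α : ℕ) → PipeDream k ℓ → PipeDream k (α + ℓ)
addCols α P r c with splitAt α c
... | inj₁ _  = true
... | inj₂ c' = P r c'

{-# OPTIONS --safe #-}
-- Read row by row, the word of α|P is that of P with every letter raised by α, except that row r
-- (0-indexed) additionally ends with the descending letters r + α − 1, …, r of the new crosses.
-- Inductively over the rows, the Demazure product of the first r rows of α|P is that of P with the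
-- values 0, …, α − 1 inserted at positions r, …, r + α − 1 and all other values raised by α
-- (Padded).  In such a permutation a raised letter is an ascent exactly when the original letter
-- is one, and the descending block consists of ascents which push the inserted values one position
-- to the right.  So α|P keeps exactly the shifted kept crosses of P together with all new crosses.
module Submission where

open import Defs
open import Data.Nat using (ℕ; zero; suc; _+_; _≡ᵇ_; _<ᵇ_; _<_; _≤_)
open import Data.Nat.Properties
open import Data.Bool using (Bool; true; false; if_then_else_)
open import Data.Bool.Properties using (if-float; T-≡)
open import Data.Fin using (Fin; toℕ; zero; suc; splitAt; _↑ˡ_; _↑ʳ_)
open import Data.Fin.Properties using (splitAt-↑ˡ; splitAt-↑ʳ; splitAt⁻¹-↑ˡ; splitAt⁻¹-↑ʳ; toℕ-↑ˡ; toℕ-↑ʳ; ↑ʳ-injective)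
open import Data.List using (List; []; _∷_; [_]; _++_; map; concatMap; reverse; foldl; take; length; lookup; applyUpTo; applyDownFrom)
open import Data.List.Properties using (∷-injectiveˡ; ∷-injectiveʳ; map-id; foldl-++; map-++; map-∘; map-cong; concatMap-map; concatMap-cong; concatMap-++; concatMap-pure; map-concatMap; reverse-++; reverse-map; reverse-applyUpTo)
open import Data.List.Relation.Unary.All using (All; []; _∷_; universal)
open import Data.List.Relation.Unary.All.Properties using (concat⁺; map⁺)
open import Data.List.Membership.Propositional using (_∈_)
open import Data.List.Membership.Propositional.Properties using (∈-map⁺; ∈-map⁻; ∈-++⁺ˡ; ∈-++⁺ʳ; ∈-++⁻)
open import Data.List.Relation.Unary.Any using (here; there)
open import Data.List.Relation.Unary.Any.Properties using (reverse⁺)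
open import Data.Product using (Σ; _×_; _,_)
open import Data.Product.Properties using (,-injective; ,-injectiveʳ)
open import Data.Sum using (_⊎_; inj₁; inj₂)
open import Data.Empty using (⊥; ⊥-elim)
open import Function using (_∘_)
open import Function.Bundles using (_⇔_; mk⇔; Equivalence)
open import Function.Properties.Equivalence using () renaming (trans to ⇔-trans; sym to ⇔-sym)
open import Relation.Binary.PropositionalEquality hiding ([_])
open import Relation.Nullary using (¬_; yes; no)
open import Relation.Nullary.Decidable using (dec-true; dec-false)

≡ᵇ-true : ∀ {m n} → m ≡ n → (m ≡ᵇ n) ≡ true
≡ᵇ-true {m} {n} = dec-true (m ≟ n)

≡ᵇ-false : ∀ {m n} → m ≢ n → (m ≡ᵇ n) ≡ false
≡ᵇ-false {m} {n} = dec-false (m ≟ n)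

+-cancelˡ-<ᵇ : ∀ a m n → (a + m <ᵇ a + n) ≡ (m <ᵇ n)
+-cancelˡ-<ᵇ zero    m n = refl
+-cancelˡ-<ᵇ (suc a) m n = +-cancelˡ-<ᵇ a m n

swapRight-at : ∀ w a → swapRight w a a ≡ w (suc a)
swapRight-at w a rewrite ≡ᵇ-true {a} refl = refl

swapRight-at-suc : ∀ w a → swapRight w a (suc a) ≡ w a
swapRight-at-suc w a rewrite ≡ᵇ-false (1+n≢n {a}) | ≡ᵇ-true {a} refl = refl

swapRight-elsewhere : ∀ w a {n} → n ≢ a → n ≢ suc a → swapRight w a n ≡ w n
swapRight-elsewhere w a n≢a n≢1+a rewrite ≡ᵇ-false n≢a | ≡ᵇ-false n≢1+a = refl

swapRight-below : ∀ w {a n} → n < a → swapRight w a n ≡ w n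
swapRight-below w {a} n<a = swapRight-elsewhere w a (<⇒≢ n<a) (<⇒≢ (m<n⇒m<1+n n<a))

swapRight-above : ∀ w {a n} → suc a < n → swapRight w a n ≡ w n
swapRight-above w {a} 1+a<n = swapRight-elsewhere w a (>⇒≢ (<-trans (n<1+n a) 1+a<n)) (>⇒≢ 1+a<n)

ascent : Perm → ℕ → Bool
ascent w a = w a <ᵇ w (suc a)

demStep-ascent : ∀ {w a} → ascent w a ≡ true → demStep w a ≡ swapRight w a
demStep-ascent {w} {a} asc = cong (λ b → if b then swapRight w a else w) asc

ascent⇒demStep-moves : ∀ {w a} → ascent w a ≡ true → ¬ (w ≈ₚ demStep w a)
ascent⇒demStep-moves {w} {a} asc w≈ = <-irrefl w[a]≡w[1+a] (<ᵇ⇒< (w a) (w (suc a)) (Equivalence.from T-≡ asc))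
  where
  w[a]≡w[1+a] : w a ≡ w (suc a)
  w[a]≡w[1+a] = trans (w≈ a) (trans (cong-app (demStep-ascent {w} {a} asc) a) (swapRight-at w a))

demStep-moves⇒ascent : ∀ {w a} → ¬ (w ≈ₚ demStep w a) → ascent w a ≡ true
demStep-moves⇒ascent {w} {a} moves with ascent w a
... | true  = refl
... | false = ⊥-elim (moves λ _ → refl)

module Run {X : Set} (f : X → ℕ) where

  run : Perm → List X → Perm
  run w xs = foldl demStep w (map f xs)

  kept : Perm → List X → List X
  kept w []       = []
  kept w (x ∷ xs) = if ascent w (f x) then x ∷ kept (demStep w (f x)) xs else kept (demStep w (f x)) xs

  -- Simplifies P D unfolds to ∀ r c → D r c ≡ true ⇔ Kept letter idPerm (crosses P) (r , c).
  Kept : Perm → List X → X → Set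
  Kept w xs x = Σ (Fin (length xs)) λ t → lookup xs t ≡ x ×
    ¬ (foldl demStep w (take (toℕ t) (map f xs)) ≈ₚ foldl demStep w (take (suc (toℕ t)) (map f xs)))

  run-++ : ∀ w xs ys → run w (xs ++ ys) ≡ run (run w xs) ys
  run-++ w xs ys = trans (cong (foldl demStep w) (map-++ f xs ys)) (foldl-++ demStep w (map f xs) (map f ys))

  kept-++ : ∀ w xs ys → kept w (xs ++ ys) ≡ kept w xs ++ kept (run w xs) ys
  kept-++ w []       ys = refl
  kept-++ w (x ∷ xs) ys =
    trans (cong (λ zs → if ascent w (f x) then x ∷ zs else zs) (kept-++ (demStep w (f x)) xs ys))
          (sym (if-float (_++ kept (run w (x ∷ xs)) ys) (ascent w (f x))))

  kept-∷-ascent : ∀ {w x} xs → ascent w (f x) ≡ true → kept w (x ∷ xs) ≡ x ∷ kept (swapRight w (f x)) xs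
  kept-∷-ascent {w} {x} xs asc =
    cong₂ (λ b v → if b then x ∷ kept v xs else kept v xs) asc (demStep-ascent asc)

  run-∷-ascent : ∀ {w x} xs → ascent w (f x) ≡ true → run w (x ∷ xs) ≡ run (swapRight w (f x)) xs
  run-∷-ascent xs asc = cong (λ v → run v xs) (demStep-ascent asc)

  private
    ∈-if⁺ : ∀ b {x y : X} {ys} → x ∈ ys → x ∈ (if b then y ∷ ys else ys)
    ∈-if⁺ true  x∈ = there x∈
    ∈-if⁺ false x∈ = x∈

    ∈-if⁻ : ∀ b {x y : X} {ys} → x ∈ (if b then y ∷ ys else ys) → (b ≡ true × x ≡ y) ⊎ x ∈ ys
    ∈-if⁻ true  (here x≡y) = inj₁ (refl , x≡y)
    ∈-if⁻ true  (there x∈) = inj₂ x∈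
    ∈-if⁻ false x∈         = inj₂ x∈

  Kept⇒∈kept : ∀ w xs {x} → Kept w xs x → x ∈ kept w xs
  Kept⇒∈kept w (y ∷ ys) (zero  , refl , moves) rewrite demStep-moves⇒ascent moves = here refl
  Kept⇒∈kept w (y ∷ ys) (suc t , lookup≡,moves)   =
    ∈-if⁺ (ascent w (f y)) (Kept⇒∈kept (demStep w (f y)) ys (t , lookup≡,moves))

  ∈kept⇒Kept : ∀ w xs {x} → x ∈ kept w xs → Kept w xs x
  ∈kept⇒Kept w (y ∷ ys) x∈ with ∈-if⁻ (ascent w (f y)) x∈
  ... | inj₁ (asc , refl) = zero , refl , ascent⇒demStep-moves asc
  ... | inj₂ x∈′ with ∈kept⇒Kept (demStep w (f y)) ys x∈′
  ...   | t , lookup≡,moves = suc t , lookup≡,moves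

  Kept⇔∈kept : ∀ w xs {x} → Kept w xs x ⇔ x ∈ kept w xs
  Kept⇔∈kept w xs = mk⇔ (Kept⇒∈kept w xs) (∈kept⇒Kept w xs)

record Padded (α r : ℕ) (u w : Perm) : Set where
  field
    below    : ∀ n → n < r → w n ≡ α + u n
    above    : ∀ n → r ≤ n → w (n + α) ≡ α + u n
    inserted : ∀ i → i < α → w (r + i) ≡ i

module _ {α : ℕ} where

  padded-id : Padded α 0 idPerm idPerm
  padded-id = record { below = λ _ (); above = λ n _ → +-comm n α; inserted = λ _ _ → refl }

  module _ {r : ℕ} {u w : Perm} (p : Padded α r u w) where
    open Padded p

    ascent-padded : ∀ {a} → r ≤ a → ascent w (a + α) ≡ ascent u a
    ascent-padded {a} r≤a =
      trans (cong₂ _<ᵇ_ (above a r≤a) (above (suc a) (m≤n⇒m≤1+n r≤a))) (+-cancelˡ-<ᵇ α (u a) (u (suc a)))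

    swapRight-padded : ∀ {a} → r ≤ a → Padded α r (swapRight u a) (swapRight w (a + α))
    swapRight-padded {a} r≤a = record { below = below′ ; above = above′ ; inserted = inserted′ }
      where
      below′ : ∀ n → n < r → swapRight w (a + α) n ≡ α + swapRight u a n
      below′ n n<r = begin
        swapRight w (a + α) n  ≡⟨ swapRight-below w (<-≤-trans n<a (m≤m+n a α)) ⟩
        w n                    ≡⟨ below n n<r ⟩
        α + u n                ≡⟨ cong (α +_) (swapRight-below u n<a) ⟨
        α + swapRight u a n    ∎
        where
        open ≡-Reasoning
        n<a = <-≤-trans n<r r≤a

      above′ : ∀ n → r ≤ n → swapRight w (a + α) (n + α) ≡ α + swapRight u a n
      above′ n r≤n with n ≟ a | n ≟ suc a
      ... | yes refl | _ = begin
        swapRight w (n + α) (n + α)  ≡⟨ swapRight-at w (n + α) ⟩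
        w (suc n + α)                ≡⟨ above (suc n) (m≤n⇒m≤1+n r≤n) ⟩
        α + u (suc n)                ≡⟨ cong (α +_) (swapRight-at u n) ⟨
        α + swapRight u n n          ∎
        where open ≡-Reasoning
      ... | no _ | yes refl = begin
        swapRight w (a + α) (suc a + α)  ≡⟨ swapRight-at-suc w (a + α) ⟩
        w (a + α)                        ≡⟨ above a r≤a ⟩
        α + u a                          ≡⟨ cong (α +_) (swapRight-at-suc u a) ⟨
        α + swapRight u a (suc a)        ∎
        where open ≡-Reasoning
      ... | no n≢a | no n≢1+a = begin
        swapRight w (a + α) (n + α)  ≡⟨ swapRight-elsewhere w (a + α) (n≢a ∘ +-cancelʳ-≡ α n a)
                                                                    (n≢1+a ∘ +-cancelʳ-≡ α n (suc a)) ⟩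
        w (n + α)                    ≡⟨ above n r≤n ⟩
        α + u n                      ≡⟨ cong (α +_) (swapRight-elsewhere u a n≢a n≢1+a) ⟨
        α + swapRight u a n          ∎
        where open ≡-Reasoning

      inserted′ : ∀ i → i < α → swapRight w (a + α) (r + i) ≡ i
      inserted′ i i<α =
        trans (swapRight-below w (<-≤-trans (+-monoʳ-< r i<α) (+-monoˡ-≤ α r≤a))) (inserted i i<α)

    demStep-padded : ∀ {a} → r ≤ a → Padded α r (demStep u a) (demStep w (a + α))
    demStep-padded {a} r≤a with ascent u a | ascent w (a + α) | ascent-padded r≤a
    ... | true  | _ | refl = swapRight-padded r≤a
    ... | false | _ | refl = p

module Shifted {X Y : Set} (f : X → ℕ) (f′ : Y → ℕ) (α : ℕ) (g : X → Y)
               (f′∘g : ∀ x → f′ (g x) ≡ f x + α) where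
  open Run

  private
    demStep-shifted : ∀ {r u w} x → r ≤ f x → Padded α r u w →
                      Padded α r (demStep u (f x)) (demStep w (f′ (g x)))
    demStep-shifted {r} {u} {w} x r≤ p =
      subst (λ a → Padded α r (demStep u (f x)) (demStep w a)) (sym (f′∘g x)) (demStep-padded p r≤)

  run-shifted : ∀ {r u w} xs → All (λ x → r ≤ f x) xs → Padded α r u w →
                Padded α r (run f u xs) (run f′ w (map g xs))
  run-shifted []       []          p = p
  run-shifted (x ∷ xs) (r≤ ∷ r≤xs) p = run-shifted xs r≤xs (demStep-shifted x r≤ p)

  kept-shifted : ∀ {r u w} xs → All (λ x → r ≤ f x) xs → Padded α r u w →
                 kept f′ w (map g xs) ≡ map g (kept f u xs)
  kept-shifted         []       []          p = refl
  kept-shifted {u = u} {w} (x ∷ xs) (r≤ ∷ r≤xs) p = begin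
      (if ascent w (f′ (g x)) then g x ∷ kept f′ w′ (map g xs) else kept f′ w′ (map g xs))
    ≡⟨ cong₂ (λ b zs → if b then g x ∷ zs else zs)
             (trans (cong (ascent w) (f′∘g x)) (ascent-padded p r≤))
             (kept-shifted xs r≤xs (demStep-shifted x r≤ p)) ⟩
      (if ascent u (f x) then g x ∷ map g (kept f u′ xs) else map g (kept f u′ xs))
    ≡⟨ if-float (map g) (ascent u (f x)) ⟨
      map g (kept f u (x ∷ xs))
    ∎
    where
    open ≡-Reasoning
    u′ = demStep u (f x)
    w′ = demStep w (f′ (g x))

record Rotated (r j : ℕ) (w w′ : Perm) : Set where
  field
    front   : w′ r ≡ w (r + j)
    shifted : ∀ i → i < j → w′ (suc (r + i)) ≡ w (r + i)
    outside : ∀ n → n < r ⊎ r + j < n → w′ n ≡ w n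

rotated-zero : ∀ {r w} → Rotated r 0 w w
rotated-zero {r} {w} = record { front = cong w (sym (+-identityʳ r)); shifted = λ _ (); outside = λ _ _ → refl }

rotated-swapRight : ∀ {r j w w′} → Rotated r j (swapRight w (r + j)) w′ → Rotated r (suc j) w w′
rotated-swapRight {r} {j} {w} {w′} rot = record { front = front′ ; shifted = shifted′ ; outside = outside′ }
  where
  open Rotated rot
  front′ : w′ r ≡ w (r + suc j)
  front′ = trans front (trans (swapRight-at w (r + j)) (cong w (sym (+-suc r j))))

  shifted′ : ∀ i → i < suc j → w′ (suc (r + i)) ≡ w (r + i)
  shifted′ i i<1+j with m<1+n⇒m<n∨m≡n i<1+j
  ... | inj₁ i<j  = trans (shifted i i<j) (swapRight-below w (+-monoʳ-< r i<j))
  ... | inj₂ refl = trans (outside (suc (r + i)) (inj₂ (n<1+n (r + i)))) (swapRight-at-suc w (r + i))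

  outside′ : ∀ n → n < r ⊎ r + suc j < n → w′ n ≡ w n
  outside′ n (inj₁ n<r) = trans (outside n (inj₁ n<r)) (swapRight-below w (<-≤-trans n<r (m≤m+n r j)))
  outside′ n (inj₂ r+1+j<n) = trans (outside n (inj₂ (<-trans (n<1+n (r + j)) 1+r+j<n))) (swapRight-above w 1+r+j<n)
    where
    1+r+j<n : suc (r + j) < n
    1+r+j<n = subst (_< n) (+-suc r j) r+1+j<n

record Dominates (r j : ℕ) (w : Perm) : Set where
  field
    dominates : ∀ i → i < j → w (r + i) < w (r + j)

module _ {r j : ℕ} {w : Perm} (dom : Dominates r (suc j) w) where
  open Dominates dom

  private
    w[r+i]<w[1+r+j] : ∀ {i} → i < suc j → w (r + i) < w (suc (r + j))
    w[r+i]<w[1+r+j] {i} i<1+j = subst (λ n → w (r + i) < w n) (+-suc r j) (dominates i i<1+j)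

  ascent-dominates : ascent w (r + j) ≡ true
  ascent-dominates = Equivalence.to T-≡ (<⇒<ᵇ (w[r+i]<w[1+r+j] (n<1+n j)))

  dominates-swapRight : Dominates r j (swapRight w (r + j))
  dominates-swapRight = record { dominates = λ i i<j →
    subst₂ _<_ (sym (swapRight-below w (+-monoʳ-< r i<j))) (sym (swapRight-at w (r + j)))
           (w[r+i]<w[1+r+j] (m<n⇒m<1+n i<j)) }

module Descending {Y : Set} (f : Y → ℕ) (r : ℕ) where
  open Run f

  Descends : ℕ → List Y → Set
  Descends j ys = map f ys ≡ applyDownFrom (r +_) j

  private
    module _ {j y ys w} (desc : Descends (suc j) (y ∷ ys)) (dom : Dominates r (suc j) w) where
      f[y]≡r+j : f y ≡ r + j
      f[y]≡r+j = ∷-injectiveˡ desc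

      ascent-head : ascent w (f y) ≡ true
      ascent-head = trans (cong (ascent w) f[y]≡r+j) (ascent-dominates dom)

      swapRight-head : swapRight w (f y) ≡ swapRight w (r + j)
      swapRight-head = cong (swapRight w) f[y]≡r+j

  kept-descending : ∀ j ys {w} → Descends j ys → Dominates r j w → kept w ys ≡ ys
  kept-descending zero    []       _    _   = refl
  kept-descending (suc j) (y ∷ ys) {w} desc dom = begin
    kept w (y ∷ ys)                    ≡⟨ kept-∷-ascent ys (ascent-head desc dom) ⟩
    y ∷ kept (swapRight w (f y)) ys    ≡⟨ cong (λ v → y ∷ kept v ys) (swapRight-head desc dom) ⟩
    y ∷ kept (swapRight w (r + j)) ys  ≡⟨ cong (y ∷_) (kept-descending j ys (∷-injectiveʳ desc)
                                                                     (dominates-swapRight dom)) ⟩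
    y ∷ ys                             ∎
    where open ≡-Reasoning

  run-descending : ∀ j ys {w} → Descends j ys → Dominates r j w → Rotated r j w (run w ys)
  run-descending zero    []       _    _   = rotated-zero
  run-descending (suc j) (y ∷ ys) {w} desc dom =
    subst (Rotated r (suc j) w) (sym run≡)
          (rotated-swapRight (run-descending j ys (∷-injectiveʳ desc) (dominates-swapRight dom)))
    where
    run≡ : run w (y ∷ ys) ≡ run (swapRight w (r + j)) ys
    run≡ = trans (run-∷-ascent ys (ascent-head desc dom)) (cong (λ v → run v ys) (swapRight-head desc dom))

module _ {α r : ℕ} {u w : Perm} (p : Padded α r u w) where
  open Padded p

  dominates-padded : Dominates r α w
  dominates-padded = record { dominates = λ i i<α →
    subst₂ _<_ (sym (inserted i i<α)) (sym (above r ≤-refl)) (<-≤-trans i<α (m≤m+n α (u r))) }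

  padded-rotated : ∀ {w′} → Rotated r α w w′ → Padded α (suc r) u w′
  padded-rotated {w′} rot = record { below = below′ ; above = above′ ; inserted = inserted′ }
    where
    open Rotated rot
    below′ : ∀ n → n < suc r → w′ n ≡ α + u n
    below′ n n<1+r with m<1+n⇒m<n∨m≡n n<1+r
    ... | inj₁ n<r  = trans (outside n (inj₁ n<r)) (below n n<r)
    ... | inj₂ refl = trans front (above n ≤-refl)

    above′ : ∀ n → suc r ≤ n → w′ (n + α) ≡ α + u n
    above′ n r<n = trans (outside (n + α) (inj₂ (+-monoˡ-< α r<n))) (above n (<⇒≤ r<n))

    inserted′ : ∀ i → i < α → w′ (suc r + i) ≡ i
    inserted′ i i<α = trans (shifted i i<α) (inserted i i<α)

finList-+ : ∀ α ℓ → finList (α + ℓ) ≡ map (_↑ˡ ℓ) (finList α) ++ map (α ↑ʳ_) (finList ℓ)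
finList-+ zero    ℓ = sym (map-id (finList ℓ))
finList-+ (suc α) ℓ = cong (zero ∷_) (begin
    map suc (finList (α + ℓ))
  ≡⟨ cong (map suc) (finList-+ α ℓ) ⟩
    map suc (map (_↑ˡ ℓ) (finList α) ++ map (α ↑ʳ_) (finList ℓ))
  ≡⟨ map-++ suc (map (_↑ˡ ℓ) (finList α)) (map (α ↑ʳ_) (finList ℓ)) ⟩
    map suc (map (_↑ˡ ℓ) (finList α)) ++ map suc (map (α ↑ʳ_) (finList ℓ))
  ≡⟨ cong₂ _++_ (trans (sym (map-∘ (finList α))) (map-∘ (finList α))) (sym (map-∘ (finList ℓ))) ⟩
    map (_↑ˡ ℓ) (map suc (finList α)) ++ map (suc α ↑ʳ_) (finList ℓ)
  ∎)
  where open ≡-Reasoning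

reverse-finList-+ : ∀ α ℓ →
  reverse (finList (α + ℓ)) ≡ map (α ↑ʳ_) (reverse (finList ℓ)) ++ map (_↑ˡ ℓ) (reverse (finList α))
reverse-finList-+ α ℓ = begin
    reverse (finList (α + ℓ))
  ≡⟨ cong reverse (finList-+ α ℓ) ⟩
    reverse (map (_↑ˡ ℓ) (finList α) ++ map (α ↑ʳ_) (finList ℓ))
  ≡⟨ reverse-++ (map (_↑ˡ ℓ) (finList α)) (map (α ↑ʳ_) (finList ℓ)) ⟩
    reverse (map (α ↑ʳ_) (finList ℓ)) ++ reverse (map (_↑ˡ ℓ) (finList α))
  ≡⟨ cong₂ _++_ (reverse-map (α ↑ʳ_) (finList ℓ)) (reverse-map (_↑ˡ ℓ) (finList α)) ⟨
    map (α ↑ʳ_) (reverse (finList ℓ)) ++ map (_↑ˡ ℓ) (reverse (finList α))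
  ∎
  where open ≡-Reasoning

map-toℕ-finList : ∀ {A : Set} n (h : ℕ → A) → map (h ∘ toℕ) (finList n) ≡ applyUpTo h n
map-toℕ-finList zero    h = refl
map-toℕ-finList (suc n) h = cong (h 0 ∷_) (trans (sym (map-∘ (finList n))) (map-toℕ-finList n (h ∘ suc)))

∈-finList : ∀ n (i : Fin n) → i ∈ finList n
∈-finList (suc n) zero    = here refl
∈-finList (suc n) (suc i) = there (∈-map⁺ suc (∈-finList n i))

data Consecutive {k : ℕ} : ℕ → List (Fin k) → Set where
  []  : ∀ {m} → Consecutive m []
  _∷_ : ∀ {m r rs} → toℕ r ≡ m → Consecutive (suc m) rs → Consecutive m (r ∷ rs)

consecutive-map-suc : ∀ {k m} {rs : List (Fin k)} → Consecutive m rs → Consecutive (suc m) (map suc rs)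
consecutive-map-suc []         = []
consecutive-map-suc (r≡ ∷ rs) = cong suc r≡ ∷ consecutive-map-suc rs

consecutive-finList : ∀ k → Consecutive 0 (finList k)
consecutive-finList zero    = []
consecutive-finList (suc k) = refl ∷ consecutive-map-suc (consecutive-finList k)

↑ʳ≢↑ˡ : ∀ α {ℓ} (c : Fin ℓ) (i : Fin α) → α ↑ʳ c ≢ i ↑ˡ ℓ
↑ʳ≢↑ˡ α {ℓ} c i eq
  with trans (sym (splitAt-↑ʳ α ℓ c)) (trans (cong (splitAt α) eq) (splitAt-↑ˡ α i ℓ))
... | ()

cells : ∀ {k ℓ} → PipeDream k ℓ → Fin k → Fin ℓ → List (Fin k × Fin ℓ)
cells P r c = if P r c then [ (r , c) ] else []

row : ∀ {k ℓ} → PipeDream k ℓ → Fin k → List (Fin k × Fin ℓ)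
row {ℓ = ℓ} P r = concatMap (cells P r) (reverse (finList ℓ))

rows : ∀ {k ℓ} → PipeDream k ℓ → List (Fin k) → List (Fin k × Fin ℓ)
rows P = concatMap (row P)

row-letters : ∀ {k ℓ} (P : PipeDream k ℓ) r → All (λ x → toℕ r ≤ letter x) (row P r)
row-letters {ℓ = ℓ} P r = concat⁺ (map⁺ (universal cell-letters (reverse (finList ℓ))))
  where
  cell-letters : ∀ c → All (λ x → toℕ r ≤ letter x) (cells P r c)
  cell-letters c with P r c
  ... | true  = m≤m+n (toℕ r) (toℕ c) ∷ []
  ... | false = []

module _ {k ℓ : ℕ} (α : ℕ) where

  addCols-↑ʳ : ∀ (P : PipeDream k ℓ) r c → addCols α P r (α ↑ʳ c) ≡ P r c
  addCols-↑ʳ P r c rewrite splitAt-↑ʳ α ℓ c = refl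

  addCols-↑ˡ : ∀ (P : PipeDream k ℓ) r i → addCols α P r (i ↑ˡ ℓ) ≡ true
  addCols-↑ˡ P r i rewrite splitAt-↑ˡ α i ℓ = refl

  shiftCell : Fin k × Fin ℓ → Fin k × Fin (α + ℓ)
  shiftCell (r , c) = r , α ↑ʳ c

  leftCell : Fin k → Fin α → Fin k × Fin (α + ℓ)
  leftCell r i = r , i ↑ˡ ℓ

  leftBlock : Fin k → List (Fin k × Fin (α + ℓ))
  leftBlock r = map (leftCell r) (reverse (finList α))

  letter-shiftCell : ∀ x → letter (shiftCell x) ≡ letter x + α
  letter-shiftCell (r , c) =
    trans (cong (toℕ r +_) (trans (toℕ-↑ʳ α c) (+-comm α (toℕ c)))) (sym (+-assoc (toℕ r) (toℕ c) α))

  letters-leftBlock : ∀ r → map letter (leftBlock r) ≡ applyDownFrom (toℕ r +_) α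
  letters-leftBlock r = begin
      map letter (map (leftCell r) (reverse (finList α)))
    ≡⟨ map-∘ (reverse (finList α)) ⟨
      map (letter ∘ leftCell r) (reverse (finList α))
    ≡⟨ map-cong (λ i → cong (toℕ r +_) (toℕ-↑ˡ i ℓ)) (reverse (finList α)) ⟩
      map ((toℕ r +_) ∘ toℕ) (reverse (finList α))
    ≡⟨ reverse-map ((toℕ r +_) ∘ toℕ) (finList α) ⟩
      reverse (map ((toℕ r +_) ∘ toℕ) (finList α))
    ≡⟨ cong reverse (map-toℕ-finList α (toℕ r +_)) ⟩
      reverse (applyUpTo (toℕ r +_) α)
    ≡⟨ reverse-applyUpTo (toℕ r +_) α ⟩
      applyDownFrom (toℕ r +_) α
    ∎
    where open ≡-Reasoning

  row-addCols : ∀ P r → row (addCols α P) r ≡ map shiftCell (row P r) ++ leftBlock r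
  row-addCols P r = begin
      concatMap (cells A r) (reverse (finList (α + ℓ)))
    ≡⟨ cong (concatMap (cells A r)) (reverse-finList-+ α ℓ) ⟩
      concatMap (cells A r) (map (α ↑ʳ_) R ++ map (_↑ˡ ℓ) L)
    ≡⟨ concatMap-++ (cells A r) (map (α ↑ʳ_) R) (map (_↑ˡ ℓ) L) ⟩
      concatMap (cells A r) (map (α ↑ʳ_) R) ++ concatMap (cells A r) (map (_↑ˡ ℓ) L)
    ≡⟨ cong₂ _++_ (concatMap-map (cells A r) (α ↑ʳ_) R) (concatMap-map (cells A r) (_↑ˡ ℓ) L) ⟩
      concatMap (cells A r ∘ (α ↑ʳ_)) R ++ concatMap (cells A r ∘ (_↑ˡ ℓ)) L
    ≡⟨ cong₂ _++_ (concatMap-cong shifted-cells R) (concatMap-cong left-cells L) ⟩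
      concatMap (map shiftCell ∘ cells P r) R ++ concatMap ([_] ∘ leftCell r) L
    ≡⟨ cong₂ _++_ (map-concatMap shiftCell (cells P r) R) (concatMap-map [_] (leftCell r) L) ⟨
      map shiftCell (row P r) ++ concatMap [_] (leftBlock r)
    ≡⟨ cong (map shiftCell (row P r) ++_) (concatMap-pure (leftBlock r)) ⟩
      map shiftCell (row P r) ++ leftBlock r
    ∎
    where
    open ≡-Reasoning
    A = addCols α P
    R = reverse (finList ℓ)
    L = reverse (finList α)

    shifted-cells : ∀ c → cells A r (α ↑ʳ c) ≡ map shiftCell (cells P r c)
    shifted-cells c rewrite addCols-↑ʳ P r c with P r c
    ... | true  = refl
    ... | false = refl

    left-cells : ∀ i → cells A r (i ↑ˡ ℓ) ≡ [ leftCell r i ]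
    left-cells i rewrite addCols-↑ˡ P r i = refl

  shiftCell-injective : ∀ {x y} → shiftCell x ≡ shiftCell y → x ≡ y
  shiftCell-injective {r , c} {r′ , c′} eq with ,-injective eq
  ... | refl , α↑c≡α↑c′ = cong (r ,_) (↑ʳ-injective α c c′ α↑c≡α↑c′)

  shiftCell∉leftBlock : ∀ x r → shiftCell x ∈ leftBlock r → ⊥
  shiftCell∉leftBlock (_ , c) r x∈ with ∈-map⁻ (leftCell r) x∈
  ... | i , _ , eq = ↑ʳ≢↑ˡ α c i (,-injectiveʳ eq)

module AddCols {k ℓ : ℕ} (α : ℕ) (P : PipeDream k ℓ) where
  open Run
  open Shifted letter letter α (shiftCell {k} {ℓ} α) (letter-shiftCell α)

  A : PipeDream k (α + ℓ)
  A = addCols α P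

  module _ {r : Fin k} {u w : Perm} (p : Padded α (toℕ r) u w) where
    private
      w′ : Perm
      w′ = run letter w (map (shiftCell α) (row P r))

      p′ : Padded α (toℕ r) (run letter u (row P r)) w′
      p′ = run-shifted (row P r) (row-letters P r) p

    kept-row-addCols : kept letter w (row A r) ≡ map (shiftCell α) (kept letter u (row P r)) ++ leftBlock α r
    kept-row-addCols = begin
        kept letter w (row A r)
      ≡⟨ cong (kept letter w) (row-addCols α P r) ⟩
        kept letter w (map (shiftCell α) (row P r) ++ leftBlock α r)
      ≡⟨ kept-++ letter w (map (shiftCell α) (row P r)) (leftBlock α r) ⟩
        kept letter w (map (shiftCell α) (row P r)) ++ kept letter w′ (leftBlock α r)
      ≡⟨ cong₂ _++_ (kept-shifted (row P r) (row-letters P r) p)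
                    (Descending.kept-descending letter (toℕ r) α (leftBlock α r) (letters-leftBlock α r)
                                                (dominates-padded p′)) ⟩
        map (shiftCell α) (kept letter u (row P r)) ++ leftBlock α r
      ∎
      where open ≡-Reasoning

    run-row-addCols : Padded α (suc (toℕ r)) (run letter u (row P r)) (run letter w (row A r))
    run-row-addCols = subst (Padded α (suc (toℕ r)) (run letter u (row P r))) (sym run≡)
      (padded-rotated p′ (Descending.run-descending letter (toℕ r) α (leftBlock α r) (letters-leftBlock α r)
                                                   (dominates-padded p′)))
      where
      run≡ : run letter w (row A r) ≡ run letter w′ (leftBlock α r)
      run≡ = trans (cong (run letter w) (row-addCols α P r))
                   (run-++ letter w (map (shiftCell α) (row P r)) (leftBlock α r))

  paddedKept : Perm → List (Fin k) → List (Fin k × Fin (α + ℓ))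
  paddedKept u []       = []
  paddedKept u (r ∷ rs) =
    (map (shiftCell α) (kept letter u (row P r)) ++ leftBlock α r) ++ paddedKept (run letter u (row P r)) rs

  kept-rows-addCols : ∀ {m u w} {rs : List (Fin k)} → Consecutive m rs → Padded α m u w →
                      kept letter w (rows A rs) ≡ paddedKept u rs
  kept-rows-addCols []                         _ = refl
  kept-rows-addCols {w = w} {r ∷ rs} (refl ∷ consec) p =
    trans (kept-++ letter w (row A r) (rows A rs))
          (cong₂ _++_ (kept-row-addCols p) (kept-rows-addCols consec (run-row-addCols p)))

  ∈-paddedKept-leftCell : ∀ u {rs r} i → r ∈ rs → leftCell α r i ∈ paddedKept u rs
  ∈-paddedKept-leftCell u {r = r} i (here refl) =
    ∈-++⁺ˡ (∈-++⁺ʳ (map (shiftCell α) (kept letter u (row P r)))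
                   (∈-map⁺ (leftCell α r) (reverse⁺ (∈-finList α i))))
  ∈-paddedKept-leftCell u i (there r∈) = ∈-++⁺ʳ _ (∈-paddedKept-leftCell _ i r∈)

  ∈-paddedKept-shiftCell⁺ : ∀ u rs {x} → x ∈ kept letter u (rows P rs) → shiftCell α x ∈ paddedKept u rs
  ∈-paddedKept-shiftCell⁺ u (r ∷ rs) x∈
    with ∈-++⁻ (kept letter u (row P r)) (subst (_ ∈_) (kept-++ letter u (row P r) (rows P rs)) x∈)
  ... | inj₁ x∈row  = ∈-++⁺ˡ (∈-++⁺ˡ (∈-map⁺ (shiftCell α) x∈row))
  ... | inj₂ x∈rest = ∈-++⁺ʳ _ (∈-paddedKept-shiftCell⁺ _ rs x∈rest)

  ∈-paddedKept-shiftCell⁻ : ∀ u rs {x} → shiftCell α x ∈ paddedKept u rs → x ∈ kept letter u (rows P rs)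
  ∈-paddedKept-shiftCell⁻ u (r ∷ rs) {x} x∈ =
    subst (_ ∈_) (sym (kept-++ letter u (row P r) (rows P rs))) (in-row-or-rest (∈-++⁻ _ x∈))
    where
    in-row-or-rest : shiftCell α x ∈ map (shiftCell α) (kept letter u (row P r)) ++ leftBlock α r
                     ⊎ shiftCell α x ∈ paddedKept (run letter u (row P r)) rs →
                     x ∈ kept letter u (row P r) ++ kept letter (run letter u (row P r)) (rows P rs)
    in-row-or-rest (inj₂ x∈rest) = ∈-++⁺ʳ _ (∈-paddedKept-shiftCell⁻ _ rs x∈rest)
    in-row-or-rest (inj₁ x∈row) with ∈-++⁻ _ x∈row
    ... | inj₂ x∈left    = ⊥-elim (shiftCell∉leftBlock α x r x∈left)
    ... | inj₁ x∈shifted with ∈-map⁻ (shiftCell α) x∈shifted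
    ...   | y , y∈ , eq = ∈-++⁺ˡ (subst (_∈ _) (sym (shiftCell-injective α eq)) y∈)

  kept-addCols : kept letter idPerm (crosses A) ≡ paddedKept idPerm (finList k)
  kept-addCols = kept-rows-addCols (consecutive-finList k) padded-id

  Kept-addCols-leftCell : ∀ r i → Kept letter idPerm (crosses A) (leftCell α r i)
  Kept-addCols-leftCell r i = ∈kept⇒Kept letter idPerm (crosses A)
    (subst (_ ∈_) (sym kept-addCols) (∈-paddedKept-leftCell idPerm i (∈-finList k r)))

  Kept-addCols-shiftCell : ∀ x → Kept letter idPerm (crosses A) (shiftCell α x) ⇔ Kept letter idPerm (crosses P) x
  Kept-addCols-shiftCell x = ⇔-trans (Kept⇔∈kept letter idPerm (crosses A)) (⇔-trans
    (subst (λ L → shiftCell α x ∈ L ⇔ x ∈ kept letter idPerm (crosses P)) (sym kept-addCols)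
           (mk⇔ (∈-paddedKept-shiftCell⁻ idPerm (finList k)) (∈-paddedKept-shiftCell⁺ idPerm (finList k))))
    (⇔-sym (Kept⇔∈kept letter idPerm (crosses P))))

addCols-pointwise⇔ : ∀ {k ℓ} α (D : PipeDream k ℓ)
                     {Q : Fin k → Fin (α + ℓ) → Set} {R : Fin k → Fin ℓ → Set} →
  (∀ r i → Q r (i ↑ˡ ℓ)) → (∀ r c → Q r (α ↑ʳ c) ⇔ R r c) →
  (∀ r c → D r c ≡ true ⇔ R r c) ⇔ (∀ r c → addCols α D r c ≡ true ⇔ Q r c)
addCols-pointwise⇔ α D {Q} {R} Q-left Q⇔R = mk⇔ to from
  where
  to : (∀ r c → D r c ≡ true ⇔ R r c) → ∀ r c → addCols α D r c ≡ true ⇔ Q r c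
  to D⇔R r c with splitAt α c in eq
  ... | inj₁ i  = mk⇔ (λ _ → subst (Q r) (splitAt⁻¹-↑ˡ eq) (Q-left r i)) (λ _ → refl)
  ... | inj₂ c′ =
    subst (λ c → D r c′ ≡ true ⇔ Q r c) (splitAt⁻¹-↑ʳ eq) (⇔-trans (D⇔R r c′) (⇔-sym (Q⇔R r c′)))

  from : (∀ r c → addCols α D r c ≡ true ⇔ Q r c) → ∀ r c → D r c ≡ true ⇔ R r c
  from A⇔Q r c =
    subst (λ b → b ≡ true ⇔ R r c) (addCols-↑ʳ α D r c) (⇔-trans (A⇔Q r (α ↑ʳ c)) (Q⇔R r c))

lemma3p1 : (k ℓ α : ℕ) (P D : PipeDream k ℓ) →
    Simplifies P D ⇔ Simplifies (addCols α P) (addCols α D)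
lemma3p1 k ℓ α P D = addCols-pointwise⇔ α D Kept-addCols-leftCell (λ r c → Kept-addCols-shiftCell (r , c))
  where open AddCols α P
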